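{- Let $k\ge 1$ and let $H_k$ be the graph constructed as follows: take the disjoint union of $k+1$ copies of $K_{2,3}$, the $i$-th copy ($i\in\{1,\dots,k+1\}$) having bipartition $\{x_i,x_i'\}$, $\{y_i,y_i',y_i''\}$; then add all edges between $x_{k+1}$ and each of $x_1,x_1',\dots,x_k,x_k'$, and all edges between $x_{k+1}'$ and each of $x_1,x_1',\dots,x_k,x_k'$. Then $H_k$ is $(k+1)$-$\gamma_{\rm MB}'$-critical, i.e. $\gamma_{\rm MB}'(H_k)=k+1$ and $\gamma_{\rm MB}'(H_k-e)>k+1$ for every edge $e\in E(H_k)$.
   Context: The Maker-Breaker domination (MBD) game on a graph $G$ is played by Dominator and Staller, who alternately select previously unselected vertices of $G$. Dominator wins if the set of vertices he has selected becomes a dominating set of $G$; Staller wins if she has selected at least one vertex of every dominating set of $G$. In the S-game Staller moves first. $\gamma_{\rm MB}'(G)$ is the minimum number $k$ such that Dominator has a strategy in the S-game guaranteeing that he wins having made at most $k$ moves, whatever Staller does; $\gamma_{\rm MB}'(G)=\infty$ if Dominator has no winning strategy in the S-game. A graph $G$ is $\gamma_{\rm MB}'$-critical if $\gamma_{\rm MB}'(G)<\gamma_{\rm MB}'(G-e)$ for every $e\in E(G)$, and $k$-$\gamma_{\rm MB}'$-critical if moreover $\gamma_{\rm MB}'(G)=k$. -}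

module Defs where

open import Data.Nat using (ℕ; zero; suc; _<_; _≤_; _*_)
open import Data.Bool using (Bool; true; false; _∧_; _∨_; not; if_then_else_)
open import Data.Fin using (Fin; fromℕ)
open import Data.Fin.Properties using () renaming (_≟_ to _≟F_)
open import Data.Product using (Σ; _×_; _,_; ∃)
open import Data.Product.Properties using (≡-dec)
open import Data.Sum using (_⊎_)
open import Relation.Binary.PropositionalEquality using (_≡_)
open import Relation.Binary.Definitions using (DecidableEquality)
open import Relation.Nullary using (¬_)
open import Relation.Nullary.Decidable using (⌊_⌋)

-- Graphs: a vertex type with decidable equality and a Bool-valued
-- adjacency relation (for the graphs used here it is symmetric and
-- irreflexive, i.e. finite simple graphs).

record Graph : Set₁ where
  field
    V    : Set
    _≟_  : DecidableEquality V
    adj  : V → V → Bool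
open Graph public

removeEdge : (G : Graph) → V G → V G → Graph
removeEdge G u v = record
  { V = V G
  ; _≟_ = _≟_ G
  ; adj = λ x y → adj G x y ∧
            not ((⌊ _≟_ G x u ⌋ ∧ ⌊ _≟_ G y v ⌋) ∨ (⌊ _≟_ G x v ⌋ ∧ ⌊ _≟_ G y u ⌋))
  }

data Owner : Set where
  free dom stal : Owner

Position : Graph → Set
Position G = V G → Owner

start : (G : Graph) → Position G
start G _ = free

claim : (G : Graph) → V G → Owner → Position G → Position G
claim G v o p w with _≟_ G w v
... | Relation.Nullary.yes _ = o
... | Relation.Nullary.no  _ = p w

Dominated : (G : Graph) → Position G → Set
Dominated G p = ∀ w → (p w ≡ dom) ⊎ (Σ (V G) λ u → (adj G u w ≡ true) × (p u ≡ dom))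

-- The game ends as soon as Dominator's set dominates (Dominator wins) or
-- when no free vertex is left for the player to move (then Dominator's set
-- does not dominate, so Staller has claimed a vertex of every dominating set).
mutual
  data WinD (G : Graph) : ℕ → Position G → Set where
    doneD : ∀ {m p} → Dominated G p → WinD G m p
    moveD : ∀ {m p} (v : V G) → p v ≡ free →
            WinS G m (claim G v dom p) → WinD G (suc m) p

  data WinS (G : Graph) : ℕ → Position G → Set where
    doneS : ∀ {m p} → Dominated G p → WinS G m p
    moveS : ∀ {m p} → (Σ (V G) λ v → p v ≡ free) →
            (∀ v → p v ≡ free → WinD G m (claim G v stal p)) → WinS G m p

γ'MB≡ : Graph → ℕ → Set
γ'MB≡ G k = WinS G k (start G) × (∀ j → j < k → ¬ WinS G j (start G))

-- γ'_MB(G) > k  (includes γ'_MB(G) = ∞)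
γ'MB> : Graph → ℕ → Set
γ'MB> G k = ∀ j → j ≤ k → ¬ WinS G j (start G)

Critical : Graph → ℕ → Set
Critical G k = γ'MB≡ G k ×
  (∀ u v → adj G u v ≡ true → γ'MB> (removeEdge G u v) k)

-- The graph H_k.  Vertex (i , j): copy i ∈ {0..k} (copy k is the
-- (k+1)-th copy), j = 0 ↦ x_i, 1 ↦ x_i', 2 ↦ y_i, 3 ↦ y_i', 4 ↦ y_i''.

isX : Fin 5 → Bool
isX Fin.zero = true
isX (Fin.suc Fin.zero) = true
isX _ = false

HAdj : (k : ℕ) → Fin (suc k) × Fin 5 → Fin (suc k) × Fin 5 → Bool
HAdj k (i , a) (j , b) =
  if ⌊ i ≟F j ⌋
  then (isX a ∧ not (isX b)) ∨ (not (isX a) ∧ isX b)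
  else (isX a ∧ isX b ∧ (⌊ i ≟F fromℕ k ⌋ ∨ ⌊ j ≟F fromℕ k ⌋))

H : ℕ → Graph
H k = record
  { V = Fin (suc k) × Fin 5
  ; _≟_ = ≡-dec _≟F_ _≟F_
  ; adj = HAdj k
  }

-- Upper bound: in every copy Dominator pairs x with x'. He answers a Staller move on x or x' of
-- a copy where he has no x yet with the other one, and any other move with an x of such a copy;
-- after k+1 moves he holds an x in every copy, which dominates H_k since the two hub x's are
-- adjacent to all other x's.
--
-- Lower bounds: the y's of a copy have all their neighbours inside it, so what Dominator still
-- needs can be bounded copy by copy, from his vertices in that copy alone. The sum of these
-- bounds drops by at most one per Dominator move, is unchanged by Staller's moves and vanishes
-- on dominated positions, so it bounds his remaining moves; for H_k it starts at k+1. Deleting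
-- an edge x_i y_i lets Staller, by claiming x_i', force two vertices in copy i. Deleting a hub
-- edge x_{k+1} x_j, Staller claims x_{k+1}', then x_j if Dominator did not take it (copy j now
-- needs two vertices) and x_{k+1} otherwise (the hub copy now needs its three y's).

module Submission where

open import Defs
open import Data.Bool using (Bool; true; false; not; _∧_; _∨_; if_then_else_) renaming (_≟_ to _≟B_)
open import Data.Bool.Properties using (∧-zeroʳ; ∨-zeroʳ; ∧-conicalˡ; ¬-not)
open import Data.Fin using (Fin; zero; suc; fromℕ; punchIn)
open import Data.Fin.Properties using (all?; any?; punchInᵢ≢i) renaming (_≟_ to _≟F_)
open import Data.Fin.Subset using (Subset; inside; outside; _∈_; _∉_; ∣_∣; _─_; _-_; _∩_; ⁅_⁆; ⊥; Nonempty)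
open import Data.Fin.Subset.Properties
  using (_∈?_; nonempty?; ∈⊤; ∣⊤∣≡n; p─q⊆p; x∈p∧x≢y⇒x∈p-y; x∈p⇒∣p-x∣<∣p∣)
open import Data.Nat using (ℕ; zero; suc; _+_; _∸_; _⊓_; _≤_; z≤n; s≤s; _≤?_) renaming (_≟_ to _≟ℕ_)
open import Data.Nat.Properties
  using (≤-trans; ≤-reflexive; ≤-pred; <⇒≱; n≤1+n; 1+n≰n; +-monoˡ-≤; +-0-commutativeMonoid; module ≤-Reasoning)
open import Algebra.Properties.CommutativeMonoid.Sum +-0-commutativeMonoid
  using (sum; sum-syntax; sum-remove; sum-cong-≗; sum-replicate-zero)
open import Data.Product using (∃; _×_; _,_; proj₁; proj₂)
open import Data.Product.Properties using (≡-dec)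
open import Data.Sum using (_⊎_; inj₁; inj₂)
open import Data.Unit using (⊤; tt)
open import Data.Vec using (_∷_; []; tabulate; lookup; _[_]≔_; there)
open import Data.Vec.Functional using (Vector; removeAt)
open import Data.Vec.Properties
  using (lookup∘tabulate; tabulate∘lookup; tabulate-cong; lookup∘update; lookup∘update′; lookup⇒[]=)
open import Function using (_∘_; _$_; id)
open import Relation.Binary.PropositionalEquality
  using (_≡_; _≢_; refl; sym; trans; cong; cong₂; subst; ≡-≟-identity; ≢-≟-identity; module ≡-Reasoning)
open import Relation.Nullary using (Dec; yes; no; ¬_; ¬?; _×-dec_; _⊎-dec_; _→-dec_)
open import Relation.Nullary.Decidable using (⌊_⌋; toSum; from-yes; map′)
open import Relation.Nullary.Negation using (contradiction)
open import Relation.Unary using (Pred; Decidable)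

allSubsets? : ∀ {n p} {P : Pred (Subset n) p} → Decidable P → Dec (∀ u → P u)
allSubsets? {zero}  P? = map′ (λ { P[] [] → P[] }) (_$ []) (P? [])
allSubsets? {suc n} P? = map′
  (λ { (P-in , P-out) (inside ∷ u) → P-in u ; (P-in , P-out) (outside ∷ u) → P-out u })
  (λ ∀P → ∀P ∘ (inside ∷_) , ∀P ∘ (outside ∷_))
  (allSubsets? (P? ∘ (inside ∷_)) ×-dec allSubsets? (P? ∘ (outside ∷_)))

x∉p-x : ∀ {n} (p : Subset n) x → x ∉ p - x
x∉p-x (_ ∷ p) zero    ()
x∉p-x (_ ∷ p) (suc x) (there x∈p-x) = x∉p-x p x x∈p-x

sum-≤-suc : ∀ {n} (f g : Vector ℕ (suc n)) i →
            f i ≤ suc (g i) → (∀ j → j ≢ i → f j ≡ g j) → sum f ≤ suc (sum g)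
sum-≤-suc f g i fi≤1+gi f≡g = begin
  sum f                          ≡⟨ sum-remove {i = i} f ⟩
  f i + sum (removeAt f i)       ≤⟨ +-monoˡ-≤ _ fi≤1+gi ⟩
  suc (g i + sum (removeAt f i)) ≡⟨ cong (λ x → suc (g i + x))
                                         (sum-cong-≗ λ j → f≡g (punchIn i j) (punchInᵢ≢i i j)) ⟩
  suc (g i + sum (removeAt g i)) ≡⟨ cong suc (sum-remove {i = i} g) ⟨
  suc (sum g)                    ∎
  where open ≤-Reasoning

sum-zero : ∀ {n} (f : Vector ℕ n) → (∀ i → f i ≡ 0) → sum f ≡ 0
sum-zero {n} f f≡0 = trans (sum-cong-≗ f≡0) (sum-replicate-zero n)

sum-ones : ∀ n → ∑[ i < n ] 1 ≡ n
sum-ones zero    = refl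
sum-ones (suc n) = cong suc (sum-ones n)

isDom : Owner → Bool
isDom dom = true
isDom _   = false

module _ (G : Graph) where

  claim-≡ : ∀ v o p → claim G v o p v ≡ o
  claim-≡ v o p with _≟_ G v v
  ... | yes _  = refl
  ... | no v≢v = contradiction refl v≢v

  claim-≢ : ∀ {v w} o p → w ≢ v → claim G v o p w ≡ p w
  claim-≢ {v} {w} o p w≢v with _≟_ G w v
  ... | yes w≡v = contradiction w≡v w≢v
  ... | no _    = refl

  claim-keeps : ∀ {v o′} w o p → p v ≡ free → p w ≡ o′ → o′ ≢ free → claim G v o p w ≡ o′
  claim-keeps w o p v-free w-o′ o′≢free =
    trans (claim-≢ o p λ { refl → o′≢free (trans (sym w-o′) v-free) }) w-o′

  stal-kept : ∀ {v} w o p → p v ≡ free → p w ≡ stal → claim G v o p w ≡ stal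
  stal-kept w o p v-free w-stal = claim-keeps w o p v-free w-stal λ ()

  claim-stal-isDom : ∀ {v} p w → p v ≡ free → isDom (claim G v stal p w) ≡ isDom (p w)
  claim-stal-isDom {v} p w v-free with _≟_ G w v
  ... | yes refl = cong isDom (sym v-free)
  ... | no _     = refl

  start-undominated : V G → ¬ Dominated G (start G)
  start-undominated w d with d w
  ... | inj₂ (_ , _ , ())

  removeEdge-removes : ∀ u v → adj (removeEdge G u v) u v ≡ false
  removeEdge-removes u v
    rewrite ≡-≟-identity (_≟_ G) {u} refl | ≡-≟-identity (_≟_ G) {v} refl = ∧-zeroʳ (adj G u v)

  removeEdge-removes′ : ∀ u v → adj (removeEdge G u v) v u ≡ false
  removeEdge-removes′ u v
    rewrite ≡-≟-identity (_≟_ G) {u} refl | ≡-≟-identity (_≟_ G) {v} refl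
          | ∨-zeroʳ (⌊ _≟_ G v u ⌋ ∧ ⌊ _≟_ G u v ⌋) = ∧-zeroʳ (adj G v u)

  removeEdge-⊆ : ∀ {u v} x y → adj (removeEdge G u v) x y ≡ true → adj G x y ≡ true
  removeEdge-⊆ x y = ∧-conicalˡ (adj G x y) _

  staller-reply : ∀ {m p v} → WinS G m p → ¬ Dominated G p → p v ≡ free →
                  WinD G m (claim G v stal p)
  staller-reply (doneS d)   ¬d = contradiction d ¬d
  staller-reply (moveS _ f) ¬d = f _

module PotentialBound
  (G : Graph) (Inv : Position G → Set) (N : Position G → ℕ)
  (Inv-claim   : ∀ {p v} o → p v ≡ free → Inv p → Inv (claim G v o p))
  (N-dom       : ∀ p v → N p ≤ suc (N (claim G v dom p)))
  (N-stal      : ∀ p v → p v ≡ free → N p ≤ N (claim G v stal p))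
  (N-dominated : ∀ {p} → Inv p → Dominated G p → N p ≡ 0)
  where

  mutual
    winD-bound : ∀ {m p} → WinD G m p → Inv p → N p ≤ m
    winD-bound (doneD d) i = ≤-trans (≤-reflexive (N-dominated i d)) z≤n
    winD-bound (moveD v v-free w) i =
      ≤-trans (N-dom _ v) (s≤s (winS-bound w (Inv-claim dom v-free i)))

    winS-bound : ∀ {m p} → WinS G m p → Inv p → N p ≤ m
    winS-bound (doneS d) i = ≤-trans (≤-reflexive (N-dominated i d)) z≤n
    winS-bound (moveS (v , v-free) f) i =
      ≤-trans (N-stal _ v v-free) (winD-bound (f v v-free) (Inv-claim stal v-free i))

Vertex : ℕ → Set
Vertex k = Fin (suc k) × Fin 5

spanning : (k : ℕ) → (Vertex k → Vertex k → Bool) → Graph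
spanning k A = record { V = Vertex k ; _≟_ = ≡-dec _≟F_ _≟F_ ; adj = A }

-- Swaps x and x'; its value on the y's is irrelevant.
other : Fin 5 → Fin 5
other zero          = suc zero
other (suc zero)    = zero
other (suc (suc _)) = zero

other-isX : ∀ a → isX (other a) ≡ true
other-isX zero          = refl
other-isX (suc zero)    = refl
other-isX (suc (suc _)) = refl

other-≢ : ∀ {a} → isX a ≡ true → other a ≢ a
other-≢ {zero}        _  ()
other-≢ {suc zero}    _  ()
other-≢ {suc (suc _)} () _

x-cases : ∀ {a b} → isX a ≡ true → isX b ≡ true → b ≡ a ⊎ b ≡ other a
x-cases {zero}     {zero}     _ _ = inj₁ refl
x-cases {zero}     {suc zero} _ _ = inj₂ refl
x-cases {suc zero} {zero}     _ _ = inj₂ refl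
x-cases {suc zero} {suc zero} _ _ = inj₁ refl

data Edge (k : ℕ) : Vertex k → Vertex k → Set where
  x-y   : ∀ {c a t} → isX a ≡ true → isX t ≡ false → Edge k (c , a) (c , t)
  y-x   : ∀ {c a t} → isX a ≡ true → isX t ≡ false → Edge k (c , t) (c , a)
  hub-x : ∀ {j a b} → j ≢ fromℕ k → isX a ≡ true → isX b ≡ true → Edge k (fromℕ k , a) (j , b)
  x-hub : ∀ {j a b} → j ≢ fromℕ k → isX a ≡ true → isX b ≡ true → Edge k (j , b) (fromℕ k , a)

edge : ∀ {k} u v → HAdj k u v ≡ true → Edge k u v
edge {k} (c , a) (d , b) with c ≟F d | isX a in xa | isX b in xb
... | yes refl | true  | false = λ _ → x-y xa xb
... | yes refl | false | true  = λ _ → y-x xb xa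
... | yes refl | true  | true  = λ ()
... | yes refl | false | false = λ ()
... | no _     | false | _     = λ ()
... | no _     | true  | false = λ ()
... | no c≢d   | true  | true  with c ≟F fromℕ k | d ≟F fromℕ k
...   | yes refl | _        = λ _ → hub-x (c≢d ∘ sym) xa xb
...   | no _     | yes refl = λ _ → x-hub c≢d xb xa
...   | no _     | no _     = λ ()

edge-adj : ∀ {k u v} → Edge k u v → HAdj k u v ≡ true
edge-adj (x-y {c} xa yt) rewrite ≡-≟-identity _≟F_ {c} refl | xa | yt = refl
edge-adj (y-x {c} xa yt) rewrite ≡-≟-identity _≟F_ {c} refl | xa | yt = refl
edge-adj {k} (hub-x j≢K xa xb)
  rewrite ≢-≟-identity _≟F_ (j≢K ∘ sym) | ≡-≟-identity _≟F_ {fromℕ k} refl | xa | xb = refl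
edge-adj {k} (x-hub j≢K xa xb)
  rewrite ≢-≟-identity _≟F_ j≢K | ≡-≟-identity _≟F_ {fromℕ k} refl | xa | xb = refl

StepBounded : (Subset 5 → ℕ) → Set
StepBounded f = ∀ a u → f u ≤ suc (f (u [ a ]≔ inside))

stepBounded? : ∀ f → Dec (StepBounded f)
stepBounded? f = all? λ a → allSubsets? λ u → f u ≤? suc (f (u [ a ]≔ inside))

-- cost u is a lower bound on the number of vertices Dominator still has to claim in a copy of
-- H_k where he holds u.
record CopyCost : Set where
  field
    cost      : Subset 5 → ℕ
    cost-step : StepBounded cost
open CopyCost

Y : Subset 5
Y = tabulate (not ∘ isX)

needAny : CopyCost
needAny = record { cost = λ u → 1 ∸ ∣ u ∣ ; cost-step = from-yes (stepBounded? λ u → 1 ∸ ∣ u ∣) }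

needAny-zero : ∀ u → Nonempty u → cost needAny u ≡ 0
needAny-zero = from-yes (allSubsets? {5} λ u → nonempty? u →-dec (1 ∸ ∣ u ∣ ≟ℕ 0))

-- A copy whose two x's belong to Staller.
needAllY : CopyCost
needAllY = record { cost = λ u → ∣ Y ─ u ∣ ; cost-step = from-yes (stepBounded? λ u → ∣ Y ─ u ∣) }

needAllY-zero : ∀ u → (∀ s → isX s ≡ false → s ∈ u) → cost needAllY u ≡ 0
needAllY-zero = from-yes (allSubsets? λ u →
  all? (λ s → isX s ≟B false →-dec s ∈? u) →-dec (∣ Y ─ u ∣ ≟ℕ 0))

-- A copy of H_k − x_a y_t in which Staller holds the x other than x_a: y_t can only be
-- dominated by itself, the other y's by x_a or by themselves.
cutXY : Fin 5 → Fin 5 → Subset 5 → ℕ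
cutXY a t u = ∣ ⁅ t ⁆ ─ u ∣ + (∣ ⁅ a ⁆ ─ u ∣ ⊓ ∣ Y - t ─ u ∣)

needCutXY : ∀ {a t} → isX a ≡ true → isX t ≡ false → CopyCost
needCutXY {a} {t} xa yt = record
  { cost      = cutXY a t
  ; cost-step = from-yes (all? λ a → all? λ t →
                  isX a ≟B true →-dec isX t ≟B false →-dec stepBounded? (cutXY a t)) a t xa yt
  }

needCutXY-zero : ∀ a t u → isX t ≡ false →
                 (∀ s → isX s ≡ false → s ∈ u ⊎ a ∈ u × s ≢ t) → cutXY a t u ≡ 0
needCutXY-zero = from-yes (all? λ a → all? λ t → allSubsets? λ u → isX t ≟B false →-dec
  (all? (λ s → isX s ≟B false →-dec (s ∈? u ⊎-dec (a ∈? u ×-dec ¬? (s ≟F t)))) →-dec (cutXY a t u ≟ℕ 0)))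

needCutXY-⊥ : ∀ a t → isX t ≡ false → cutXY a t ⊥ ≡ 2
needCutXY-⊥ = from-yes (all? λ a → all? λ t → isX t ≟B false →-dec (cutXY a t ⊥ ≟ℕ 2))

-- Copy j of H_k − x_{k+1} x_j once Staller holds x_j and the hub x other than x_{k+1}: x_j must
-- be dominated by a y of copy j, and each y by itself or by b, the other x of copy j.
cutHub : Fin 5 → Subset 5 → ℕ
cutHub b u = (1 ∸ ∣ Y ∩ u ∣) + (∣ ⁅ b ⁆ ─ u ∣ ⊓ ∣ Y ─ u ∣)

needCutHub : ∀ {b} → isX b ≡ true → CopyCost
needCutHub {b} xb = record
  { cost      = cutHub b
  ; cost-step = from-yes (all? λ b → isX b ≟B true →-dec stepBounded? (cutHub b)) b xb
  }

needCutHub-zero : ∀ b u → (∃ λ s → isX s ≡ false × s ∈ u) →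
                  (∀ s → isX s ≡ false → s ∈ u ⊎ b ∈ u) → cutHub b u ≡ 0
needCutHub-zero = from-yes (all? λ b → allSubsets? λ u →
  any? (λ s → isX s ≟B false ×-dec s ∈? u) →-dec
  (all? (λ s → isX s ≟B false →-dec (s ∈? u ⊎-dec b ∈? u)) →-dec (cutHub b u ≟ℕ 0)))

needCutHub-⊥ : ∀ b → cutHub b ⊥ ≡ 2
needCutHub-⊥ = from-yes (all? λ b → cutHub b ⊥ ≟ℕ 2)

module Spanning {k : ℕ} (A : Vertex k → Vertex k → Bool)
                (A⊆H : ∀ u v → A u v ≡ true → HAdj k u v ≡ true) where

  G : Graph
  G = spanning k A

  y-dominator : ∀ {p c s} → Dominated G p → isX s ≡ false →
                p (c , s) ≡ dom ⊎ ∃ λ b → isX b ≡ true × A (c , b) (c , s) ≡ true × p (c , b) ≡ dom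
  y-dominator {c = c} {s} d ys with d (c , s)
  ... | inj₁ s-dom = inj₁ s-dom
  ... | inj₂ ((c′ , b) , bA , b-dom) with edge (c′ , b) (c , s) (A⊆H _ _ bA)
  ...   | x-y xb _     = inj₂ (b , xb , bA , b-dom)
  ...   | y-x xs _     = contradiction (trans (sym xs) ys) λ ()
  ...   | hub-x _ _ xs = contradiction (trans (sym xs) ys) λ ()
  ...   | x-hub _ xs _ = contradiction (trans (sym xs) ys) λ ()

  trace : Position G → Fin (suc k) → Subset 5
  trace p c = tabulate (λ a → isDom (p (c , a)))

  ∈-trace : ∀ {p c a} → p (c , a) ≡ dom → a ∈ trace p c
  ∈-trace {p} {c} {a} a-dom =
    lookup⇒[]= a _ (trans (lookup∘tabulate (λ b → isDom (p (c , b))) a) (cong isDom a-dom))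

  nonhub-x-dominator : ∀ {p j b} → j ≢ fromℕ k → isX b ≡ true → Dominated G p → p (j , b) ≢ dom →
    (∃ λ s → isX s ≡ false × s ∈ trace p j) ⊎
    (∃ λ a → isX a ≡ true × A (fromℕ k , a) (j , b) ≡ true × p (fromℕ k , a) ≡ dom)
  nonhub-x-dominator {p} {j} {b} j≢K xb d b-¬dom with d (j , b)
  ... | inj₁ b-dom = contradiction b-dom b-¬dom
  ... | inj₂ ((c , s) , sA , s-dom) with edge (c , s) (j , b) (A⊆H _ _ sA)
  ...   | x-y _ yb     = contradiction (trans (sym xb) yb) λ ()
  ...   | y-x _ ys     = inj₁ (s , ys , ∈-trace {p} s-dom)
  ...   | hub-x _ xs _ = inj₂ (s , xs , sA , s-dom)
  ...   | x-hub _ _ _  = contradiction refl j≢K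

  trace-claim-dom : ∀ p c a → trace (claim G (c , a) dom p) c ≡ trace p c [ a ]≔ inside
  trace-claim-dom p c a = trans (tabulate-cong pointwise) (tabulate∘lookup _)
    where
    pointwise : ∀ b → isDom (claim G (c , a) dom p (c , b)) ≡ lookup (trace p c [ a ]≔ inside) b
    pointwise b with b ≟F a
    ... | yes refl = trans (cong isDom (claim-≡ G (c , a) dom p)) (sym (lookup∘update a (trace p c) inside))
    ... | no b≢a   = trans (cong isDom (claim-≢ G {c , a} {c , b} dom p (b≢a ∘ cong proj₂)))
                       (trans (sym (lookup∘tabulate (λ b → isDom (p (c , b))) b))
                              (sym (lookup∘update′ b≢a (trace p c) inside)))

  trace-claim-elsewhere : ∀ {c d} o p a → d ≢ c → trace (claim G (c , a) o p) d ≡ trace p d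
  trace-claim-elsewhere {c} {d} o p a d≢c =
    tabulate-cong λ b → cong isDom (claim-≢ G {c , a} {d , b} o p (d≢c ∘ cong proj₁))

  trace-claim-stal : ∀ {p v} → p v ≡ free → ∀ c → trace (claim G v stal p) c ≡ trace p c
  trace-claim-stal {p} v-free c = tabulate-cong λ b → claim-stal-isDom G p (c , b) v-free

  need : (Fin (suc k) → CopyCost) → Position G → ℕ
  need φ p = ∑[ c < suc k ] cost (φ c) (trace p c)

  need-dom : ∀ φ p v → need φ p ≤ suc (need φ (claim G v dom p))
  need-dom φ p (c , a) = sum-≤-suc _ _ c
    (subst (λ u → cost (φ c) (trace p c) ≤ suc (cost (φ c) u)) (sym (trace-claim-dom p c a))
           (cost-step (φ c) a (trace p c)))
    (λ d d≢c → cong (cost (φ d)) (sym (trace-claim-elsewhere dom p a d≢c)))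

  need-stal : ∀ φ {p v} → p v ≡ free → need φ p ≡ need φ (claim G v stal p)
  need-stal φ {p} {v} v-free = sum-cong-≗ λ c → cong (cost (φ c)) (sym (trace-claim-stal {p} {v} v-free c))

  focus : Fin (suc k) → CopyCost → Fin (suc k) → CopyCost
  focus i r c = if ⌊ c ≟F i ⌋ then r else needAny

  focus-≡ : ∀ i r → focus i r i ≡ r
  focus-≡ i r rewrite ≡-≟-identity _≟F_ {i} refl = refl

  focus-≢ : ∀ {i c} r → c ≢ i → focus i r c ≡ needAny
  focus-≢ r c≢i rewrite ≢-≟-identity _≟F_ c≢i = refl

  need-start : ∀ i r → need (focus i r) (start G) ≡ cost r ⊥ + k
  need-start i r = begin
    need (focus i r) (start G)
      ≡⟨ sum-remove {i = i} (λ c → cost (focus i r c) (trace (start G) c)) ⟩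
    cost (focus i r i) ⊥ + ∑[ j < k ] cost (focus i r (punchIn i j)) ⊥
      ≡⟨ cong₂ _+_ (cong (λ φ → cost φ ⊥) (focus-≡ i r))
                   (sum-cong-≗ λ j → cong (λ φ → cost φ ⊥) (focus-≢ r (punchInᵢ≢i i j))) ⟩
    cost r ⊥ + ∑[ j < k ] 1
      ≡⟨ cong (cost r ⊥ +_) (sum-ones k) ⟩
    cost r ⊥ + k
      ∎
    where open ≡-Reasoning

  need-opening : ∀ i r v → need (focus i r) (claim G v stal (start G)) ≡ cost r ⊥ + k
  need-opening i r v = trans (sym (need-stal (focus i r) {start G} {v} refl)) (need-start i r)

  needAny-dominated : ∀ {p} → Dominated G p → ∀ c → cost needAny (trace p c) ≡ 0
  needAny-dominated {p} d c with y-dominator {p} {c} {suc (suc zero)} d refl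
  ... | inj₁ s-dom               = needAny-zero _ (_ , ∈-trace {p} {c} s-dom)
  ... | inj₂ (_ , _ , _ , b-dom) = needAny-zero _ (_ , ∈-trace {p} {c} b-dom)

  need-dominated : ∀ {p} i r → Dominated G p → cost r (trace p i) ≡ 0 → need (focus i r) p ≡ 0
  need-dominated {p} i r d r-zero = sum-zero _ λ c → zero-at c (c ≟F i)
    where
    zero-at : ∀ c → Dec (c ≡ i) → cost (focus i r c) (trace p c) ≡ 0
    zero-at c (yes refl) = trans (cong (λ φ → cost φ (trace p c)) (focus-≡ i r)) r-zero
    zero-at c (no c≢i)   = trans (cong (λ φ → cost φ (trace p c)) (focus-≢ r c≢i)) (needAny-dominated d c)

  opening-undominated : ∀ {v} → ¬ Dominated G (claim G v stal (start G))
  opening-undominated {v} d with trans (sym (need-opening zero needAny v))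
                                      (need-dominated zero needAny d (needAny-dominated d zero))
  ... | ()

  reply-undominated : 1 ≤ k → ∀ {v w} → ¬ Dominated G (claim G v dom (claim G w stal (start G)))
  reply-undominated 1≤k {v} {w} d = 1+n≰n (≤-trans (s≤s 1≤k) 1+k≤1)
    where
    φ : Fin (suc k) → CopyCost
    φ = focus zero needAny
    q : Position G
    q = claim G w stal (start G)
    1+k≤1 : suc k ≤ 1
    1+k≤1 = begin
      suc k                          ≡⟨ need-opening zero needAny w ⟨
      need φ q                       ≤⟨ need-dom φ q v ⟩
      suc (need φ (claim G v dom q)) ≡⟨ cong suc (need-dominated zero needAny d (needAny-dominated d zero)) ⟩
      1                              ∎
      where open ≤-Reasoning hiding (start)

  module NeedBound
    (Inv : Position G → Set)
    (Inv-claim : ∀ {p v} o → p v ≡ free → Inv p → Inv (claim G v o p))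
    (i : Fin (suc k)) (r : CopyCost)
    (r-dominated : ∀ {p} → Inv p → Dominated G p → cost r (trace p i) ≡ 0)
    where

    open PotentialBound G Inv (need (focus i r)) Inv-claim (need-dom (focus i r))
      (λ p v v-free → ≤-reflexive (need-stal (focus i r) {p} v-free))
      (λ {p} inv d → need-dominated {p} i r d (r-dominated inv d)) public

    round-bound : ∀ {m p v w} → WinS G m (claim G v dom p) → ¬ Dominated G (claim G v dom p) →
                  claim G v dom p w ≡ free → Inv (claim G w stal (claim G v dom p)) →
                  need (focus i r) p ≤ suc m
    round-bound {p = p} {v} {w} win undominated w-free inv =
      ≤-trans (need-dom (focus i r) p v)
        (s≤s (≤-trans (≤-reflexive (need-stal (focus i r) {claim G v dom p} {w} w-free))
                      (winD-bound (staller-reply G win undominated w-free) inv)))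

H-lower-bound : ∀ k {m} → WinS (H k) m (start (H k)) → suc k ≤ m
H-lower-bound k {m} w = subst (_≤ m) (need-start zero needAny) (winS-bound w tt)
  where
  open Spanning (HAdj k) (λ _ _ → id)
  open NeedBound (λ _ → ⊤) (λ _ _ _ → tt) zero needAny (λ _ d → needAny-dominated d zero)

0≢hub : ∀ {k} → 1 ≤ k → zero ≢ fromℕ k
0≢hub {suc _} _ ()

module Pairing {k} (1≤k : 1 ≤ k) where

  G : Graph
  G = H k

  Secured : Position G → Fin (suc k) → Set
  Secured p c = ∃ λ b → isX b ≡ true × p (c , b) ≡ dom

  Fresh : Position G → Fin (suc k) → Set
  Fresh p c = ∀ {b} → isX b ≡ true → p (c , b) ≡ free

  record Invariant (p : Position G) (F : Subset (suc k)) : Set where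
    field
      fresh   : ∀ {c} → c ∈ F → Fresh p c
      secured : ∀ {c} → c ∉ F → Secured p c
  open Invariant

  secured-dominated : ∀ {p} → (∀ c → Secured p c) → Dominated G p
  secured-dominated sec (c , s) with toSum (isX s ≟B false) | toSum (c ≟F fromℕ k)
  ... | inj₁ ys | _ = let (b , xb , b-dom) = sec c in inj₂ ((c , b) , edge-adj (x-y xb ys) , b-dom)
  ... | inj₂ ¬ys | inj₁ refl = let (b , xb , b-dom) = sec zero in
    inj₂ ((zero , b) , edge-adj (x-hub (0≢hub 1≤k) (¬-not ¬ys) xb) , b-dom)
  ... | inj₂ ¬ys | inj₂ c≢K = let (b , xb , b-dom) = sec (fromℕ k) in
    inj₂ ((fromℕ k , b) , edge-adj (hub-x c≢K xb (¬-not ¬ys)) , b-dom)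

  record Reply (F : Subset (suc k)) (v : Vertex k) : Set where
    field
      copy   : Fin (suc k)
      x      : Fin 5
      copy∈F : copy ∈ F
      isX-x  : isX x ≡ true
      x≢v    : (copy , x) ≢ v
      spared : ∀ {c b} → c ∈ F → c ≢ copy → isX b ≡ true → (c , b) ≢ v

  reply : ∀ {F d} → d ∈ F → ∀ v → Reply F v
  reply {F} {d} d∈F (c , a) with c ∈? F | isX a in xa
  ... | yes c∈F | true  = record
    { copy = c ; x = other a ; copy∈F = c∈F ; isX-x = other-isX a
    ; x≢v = other-≢ xa ∘ cong proj₂ ; spared = λ _ c′≢c _ → c′≢c ∘ cong proj₁ }
  ... | yes _   | false = record
    { copy = d ; x = zero ; copy∈F = d∈F ; isX-x = refl
    ; x≢v = λ e → contradiction (trans (cong (isX ∘ proj₂) e) xa) λ ()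
    ; spared = λ _ _ xb e → contradiction (trans (sym xb) (trans (cong (isX ∘ proj₂) e) xa)) λ () }
  ... | no c∉F  | _     = record
    { copy = d ; x = zero ; copy∈F = d∈F ; isX-x = refl
    ; x≢v = λ e → c∉F (subst (_∈ F) (cong proj₁ e) d∈F)
    ; spared = λ c′∈F _ _ e → c∉F (subst (_∈ F) (cong proj₁ e) c′∈F) }

  pairing-wins : ∀ m {p F} → ∣ F ∣ ≤ m → Invariant p F → WinS G m p
  pairing-wins m {F = F} ∣F∣≤m inv with nonempty? F
  ... | no F-empty = doneS (secured-dominated λ c → secured inv λ c∈F → F-empty (c , c∈F))
  pairing-wins zero    ∣F∣≤0 inv | yes (d , d∈F) =
    contradiction (≤-trans (x∈p⇒∣p-x∣<∣p∣ d∈F) ∣F∣≤0) λ ()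
  pairing-wins (suc m) {p} {F} ∣F∣≤1+m inv | yes (d , d∈F) =
    moveS ((d , zero) , fresh inv d∈F refl) λ v v-free → answer (reply d∈F v) v-free
    where
    answer : ∀ {v} → Reply F v → p v ≡ free → WinD G (suc m) (claim G v stal p)
    answer {v} R v-free =
      moveD (copy , x) x-free (pairing-wins m (≤-pred (≤-trans (x∈p⇒∣p-x∣<∣p∣ copy∈F) ∣F∣≤1+m)) inv′)
      where
      open Reply R
      q p′ : Position G
      q  = claim G v stal p
      p′ = claim G (copy , x) dom q

      x-free : q (copy , x) ≡ free
      x-free = trans (claim-≢ G stal p x≢v) (fresh inv copy∈F isX-x)

      fresh′ : ∀ {c} → c ∈ F - copy → Fresh p′ c
      fresh′ {c} c∈F-copy xb =
        trans (claim-≢ G dom q (c≢copy ∘ cong proj₁))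
              (trans (claim-≢ G stal p (spared c∈F c≢copy xb)) (fresh inv c∈F xb))
        where
        c∈F : c ∈ F
        c∈F = p─q⊆p F ⁅ copy ⁆ c∈F-copy
        c≢copy : c ≢ copy
        c≢copy refl = x∉p-x F copy c∈F-copy

      secured′ : ∀ {c} → c ∉ F - copy → Secured p′ c
      secured′ {c} c∉F-copy with toSum (c ≟F copy)
      ... | inj₁ refl = x , isX-x , claim-≡ G (copy , x) dom q
      ... | inj₂ c≢copy =
        let (b , xb , b-dom) = secured inv λ c∈F → c∉F-copy (x∈p∧x≢y⇒x∈p-y c∈F c≢copy) in
        b , xb , claim-keeps G (c , b) dom q x-free (claim-keeps G (c , b) stal p v-free b-dom λ ()) λ ()

      inv′ : Invariant p′ (F - copy)
      inv′ = record { fresh = fresh′ ; secured = secured′ }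

  pairing-strategy : WinS G (suc k) (start G)
  pairing-strategy = pairing-wins (suc k) (≤-reflexive (∣⊤∣≡n (suc k)))
    record { fresh = λ _ _ → refl ; secured = λ c∉⊤ → contradiction ∈⊤ c∉⊤ }

module CutXY {k} (A : Vertex k → Vertex k → Bool) (A⊆H : ∀ u v → A u v ≡ true → HAdj k u v ≡ true)
             {i a t} (xa : isX a ≡ true) (yt : isX t ≡ false) (cut : A (i , a) (i , t) ≡ false) where

  open Spanning A A⊆H

  Inv : Position G → Set
  Inv p = p (i , other a) ≡ stal

  cutXY-dominated : ∀ {p} → Inv p → Dominated G p → cutXY a t (trace p i) ≡ 0
  cutXY-dominated {p} x′-stal d = needCutXY-zero a t (trace p i) yt covered
    where
    covered : ∀ s → isX s ≡ false → s ∈ trace p i ⊎ a ∈ trace p i × s ≢ t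
    covered s ys with y-dominator {p} {i} d ys
    ... | inj₁ s-dom = inj₁ (∈-trace {p} s-dom)
    ... | inj₂ (b , xb , bA , b-dom) with x-cases xa xb
    ...   | inj₁ refl = inj₂ (∈-trace {p} b-dom , λ { refl → contradiction (trans (sym bA) cut) λ () })
    ...   | inj₂ refl = contradiction (trans (sym x′-stal) b-dom) λ ()

  open NeedBound Inv (λ o → stal-kept G (i , other a) o _)
    i (needCutXY xa yt) cutXY-dominated

  cutXY-bound : γ'MB> G (suc k)
  cutXY-bound m m≤1+k w = 1+n≰n (≤-trans 2+k≤m m≤1+k)
    where
    q : Position G
    q = claim G (i , other a) stal (start G)
    2+k≤m : 2 + k ≤ m
    2+k≤m = begin
      2 + k                                ≡⟨ cong (_+ k) (needCutXY-⊥ a t yt) ⟨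
      cutXY a t ⊥ + k                      ≡⟨ need-opening i (needCutXY xa yt) (i , other a) ⟨
      need (focus i (needCutXY xa yt)) q   ≤⟨ winD-bound (staller-reply G w (start-undominated G (i , a)) refl)
                                                         (claim-≡ G (i , other a) stal (start G)) ⟩
      m                                    ∎
      where open ≤-Reasoning hiding (start)

module CutHub {k} (A : Vertex k → Vertex k → Bool) (A⊆H : ∀ u v → A u v ≡ true → HAdj k u v ≡ true)
              {j a b} (j≢K : j ≢ fromℕ k) (xa : isX a ≡ true) (xb : isX b ≡ true)
              (cut : A (fromℕ k , a) (j , b) ≡ false) where

  open Spanning A A⊆H

  X X′ Z : Vertex k
  X  = fromℕ k , a
  X′ = fromℕ k , other a
  Z  = j , b

  cutHub-dominated : ∀ {p} → p X′ ≡ stal × p Z ≡ stal → Dominated G p →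
                     cutHub (other b) (trace p j) ≡ 0
  cutHub-dominated {p} (X′-stal , Z-stal) d =
    needCutHub-zero (other b) (trace p j) Z-dominator covered
    where
    Z-dominator : ∃ λ s → isX s ≡ false × s ∈ trace p j
    Z-dominator with nonhub-x-dominator {p} j≢K xb d (λ Z-dom → contradiction (trans (sym Z-stal) Z-dom) λ ())
    ... | inj₁ y = y
    ... | inj₂ (s , xs , sA , s-dom) with x-cases xa xs
    ...   | inj₁ refl = contradiction (trans (sym sA) cut) λ ()
    ...   | inj₂ refl = contradiction (trans (sym X′-stal) s-dom) λ ()
    covered : ∀ s → isX s ≡ false → s ∈ trace p j ⊎ other b ∈ trace p j
    covered s ys with y-dominator {p} {j} d ys
    ... | inj₁ s-dom = inj₁ (∈-trace {p} s-dom)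
    ... | inj₂ (b′ , xb′ , _ , b′-dom) with x-cases xb xb′
    ...   | inj₁ refl = contradiction (trans (sym Z-stal) b′-dom) λ ()
    ...   | inj₂ refl = inj₂ (∈-trace {p} b′-dom)

  allY-dominated : ∀ {p} → p X ≡ stal × p X′ ≡ stal → Dominated G p →
                   ∣ Y ─ trace p (fromℕ k) ∣ ≡ 0
  allY-dominated {p} (X-stal , X′-stal) d = needAllY-zero (trace p (fromℕ k)) covered
    where
    covered : ∀ s → isX s ≡ false → s ∈ trace p (fromℕ k)
    covered s ys with y-dominator {p} {fromℕ k} d ys
    ... | inj₁ s-dom = ∈-trace {p} s-dom
    ... | inj₂ (b′ , xb′ , _ , b′-dom) with x-cases xa xb′
    ...   | inj₁ refl = contradiction (trans (sym X-stal) b′-dom) λ ()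
    ...   | inj₂ refl = contradiction (trans (sym X′-stal) b′-dom) λ ()

  module StallerTakesZ = NeedBound (λ p → p X′ ≡ stal × p Z ≡ stal)
    (λ o v-free (X′-stal , Z-stal) → stal-kept G X′ o _ v-free X′-stal , stal-kept G Z o _ v-free Z-stal)
    j (needCutHub (other-isX b)) cutHub-dominated

  module StallerTakesX = NeedBound (λ p → p X ≡ stal × p X′ ≡ stal)
    (λ o v-free (X-stal , X′-stal) → stal-kept G X o _ v-free X-stal , stal-kept G X′ o _ v-free X′-stal)
    (fromℕ k) needAllY allY-dominated

  cutHub-bound : 1 ≤ k → γ'MB> G (suc k)
  cutHub-bound 1≤k m m≤1+k w = after-opening (staller-reply G w (start-undominated G Z) refl) m≤1+k
    where
    open ≤-Reasoning hiding (start)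

    q : Position G
    q = claim G X′ stal (start G)

    X′-stal : ∀ {v} → q v ≡ free → claim G v dom q X′ ≡ stal
    X′-stal v-free = stal-kept G X′ dom q v-free (claim-≡ G X′ stal (start G))

    too-long : ∀ {m′} → 2 + k ≤ suc m′ → ¬ m′ ≤ k
    too-long 2+k≤1+m′ m′≤k = 1+n≰n (≤-trans 2+k≤1+m′ (s≤s m′≤k))

    after-reply : ∀ {m′} v → q v ≡ free → WinS G m′ (claim G v dom q) → ¬ m′ ≤ k
    after-reply {m′} v v-free w with _≟_ G Z v
    ... | no Z≢v = too-long (begin
      2 + k                                       ≡⟨ cong (_+ k) (needCutHub-⊥ (other b)) ⟨
      cutHub (other b) ⊥ + k                      ≡⟨ need-opening j (needCutHub (other-isX b)) X′ ⟨
      need (focus j (needCutHub (other-isX b))) q ≤⟨ StallerTakesZ.round-bound w (reply-undominated 1≤k)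
                                                       Z-free (X′-kept , claim-≡ G Z stal _) ⟩
      suc m′                                      ∎)
      where
      Z-free : claim G v dom q Z ≡ free
      Z-free = trans (claim-≢ G dom q Z≢v) (claim-≢ G stal (start G) (j≢K ∘ cong proj₁))
      X′-kept : claim G Z stal (claim G v dom q) X′ ≡ stal
      X′-kept = stal-kept G X′ stal _ Z-free (X′-stal v-free)
    ... | yes refl = too-long (≤-trans (n≤1+n _) (begin
      3 + k                             ≡⟨ need-opening (fromℕ k) needAllY X′ ⟨
      need (focus (fromℕ k) needAllY) q ≤⟨ StallerTakesX.round-bound w (reply-undominated 1≤k)
                                             X-free (claim-≡ G X stal _ , X′-kept) ⟩
      suc m′                            ∎))
      where
      X-free : claim G Z dom q X ≡ free
      X-free = trans (claim-≢ G {Z} {X} dom q (j≢K ∘ sym ∘ cong proj₁))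
                     (claim-≢ G {X′} {X} stal (start G) (other-≢ xa ∘ sym ∘ cong proj₂))
      X′-kept : claim G X stal (claim G Z dom q) X′ ≡ stal
      X′-kept = stal-kept G X′ stal _ X-free (X′-stal v-free)

    after-opening : ∀ {m} → WinD G m q → ¬ m ≤ suc k
    after-opening (doneD d)          _         = opening-undominated d
    after-opening (moveD v v-free w) (s≤s m≤k) = after-reply v v-free w m≤k

edge-removal-bound : ∀ {k} → 1 ≤ k → ∀ u v → Edge k u v → γ'MB> (removeEdge (H k) u v) (suc k)
edge-removal-bound {k} _ u v (x-y {c} xa yt) =
  CutXY.cutXY-bound _ (removeEdge-⊆ (H k)) {c} xa yt (removeEdge-removes (H k) u v)
edge-removal-bound {k} _ u v (y-x {c} xa yt) =
  CutXY.cutXY-bound _ (removeEdge-⊆ (H k)) {c} xa yt (removeEdge-removes′ (H k) u v)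
edge-removal-bound {k} 1≤k u v (hub-x j≢K xa xb) =
  CutHub.cutHub-bound _ (removeEdge-⊆ (H k)) j≢K xa xb (removeEdge-removes (H k) u v) 1≤k
edge-removal-bound {k} 1≤k u v (x-hub j≢K xa xb) =
  CutHub.cutHub-bound _ (removeEdge-⊆ (H k)) j≢K xa xb (removeEdge-removes′ (H k) u v) 1≤k

proposition3p3 : (k : ℕ) → 1 ≤ k → Critical (H k) (suc k)
proposition3p3 k 1≤k =
  (Pairing.pairing-strategy 1≤k , λ m m<1+k w → <⇒≱ m<1+k (H-lower-bound k w)) ,
  λ u v uv → edge-removal-bound 1≤k u v (edge u v uv)
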